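{- Let $p,q,k,n$ be positive integers with $\gcd(p+q,k)>p$. Then in the game $mBox(n \times k,(p,q))$ in which Enforcer moves first, Avoider has a strategy such that he never makes a dangerous move, i.e. in each of his moves every element he claims lies in a safe box.
   Context: The game $mBox(n\times k,(p,q))$ is the $(p,q)$ Avoider-Enforcer game with strict rules (Avoider and Enforcer alternately claim exactly $p$ and exactly $q$ previously unclaimed elements per move, respectively; a player facing fewer unclaimed elements than his bias claims all of them; the game ends when all elements are claimed; Avoider loses if he claims all elements of some target set) whose board is the disjoint union of $n$ pairwise disjoint boxes $B_1,\ldots,B_n$ of size $k$, with the boxes as target sets. A box is surviving if not all of its elements are claimed. A surviving box in which Enforcer has not claimed any element is dangerous; a surviving box in which Enforcer has claimed at least one element is safe. An unclaimed element of a safe box is a safe element. A move of Avoider is safe if every element he claims in it is a safe element at the moment he claims it; otherwise the move is dangerous. -}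

module Defs where

open import Data.Nat using (ℕ; zero; suc; _+_; _⊓_)
open import Data.Fin using (Fin)
open import Data.Bool using (Bool; true; false; if_then_else_)
open import Data.List using (List; map; allFin)
open import Data.Nat.ListAction using (sum)
open import Data.Product using (∃; _×_)
open import Relation.Binary.PropositionalEquality using (_≡_)
open import Relation.Nullary using (¬_)

-- Board of  mBox(n × k, (p,q)) : elements are pairs (i , j) with i : Fin n
-- the box index and j : Fin k the position inside box B_i.
data Owner : Set where
  free avoider enforcer : Owner

Position : ℕ → ℕ → Set
Position n k = Fin n → Fin k → Owner

Selection : ℕ → ℕ → Set
Selection n k = Fin n → Fin k → Bool

count : ∀ {n k} → Selection n k → ℕ
count {n} {k} S =
  sum (map (λ i → sum (map (λ j → if S i j then 1 else 0) (allFin k))) (allFin n))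

isFree : Owner → Bool
isFree free = true
isFree avoider = false
isFree enforcer = false

freeCount : ∀ {n k} → Position n k → ℕ
freeCount pos = count (λ i j → isFree (pos i j))

AllClaimed : ∀ {n k} → Position n k → Set
AllClaimed pos = ∀ i j → ¬ (pos i j ≡ free)

-- strict rules: a move with bias b claims exactly b unclaimed elements,
-- or all unclaimed elements if fewer than b remain
LegalMove : ∀ {n k} → ℕ → Position n k → Selection n k → Set
LegalMove b pos S = (∀ i j → S i j ≡ true → pos i j ≡ free)
                  × count S ≡ b ⊓ freeCount pos

apply : ∀ {n k} → Position n k → Selection n k → Owner → Position n k
apply pos S o i j = if S i j then o else pos i j

Surviving : ∀ {n k} → Position n k → Fin n → Set
Surviving pos i = ∃ λ j → pos i j ≡ free

SafeBox : ∀ {n k} → Position n k → Fin n → Set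
SafeBox pos i = Surviving pos i × ∃ λ j → pos i j ≡ enforcer

SafeElement : ∀ {n k} → Position n k → Fin n → Fin k → Set
SafeElement pos i j = pos i j ≡ free × SafeBox pos i

-- Avoider's move S (made in position pos) is safe if every element he claims
-- is a safe element at the moment he claims it.  Within Avoider's move only
-- Avoider claims elements, and claiming elements of a safe box never makes
-- another still-unclaimed element of it unsafe, so this is the same as every
-- element of S being safe in pos.
SafeMove : ∀ {n k} → Position n k → Selection n k → Set
SafeMove pos S = ∀ i j → S i j ≡ true → SafeElement pos i j

-- Game tree semantics: "Avoider has a strategy guaranteeing that all his moves
-- are safe, whatever Enforcer does".
mutual
  data EnforcerTurn {n k : ℕ} (p q : ℕ) (pos : Position n k) : Set where
    enf-done : AllClaimed pos → EnforcerTurn p q pos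
    enf-step : ¬ AllClaimed pos →
               (∀ S → LegalMove q pos S → AvoiderTurn p q (apply pos S enforcer)) →
               EnforcerTurn p q pos

  data AvoiderTurn {n k : ℕ} (p q : ℕ) (pos : Position n k) : Set where
    av-done : AllClaimed pos → AvoiderTurn p q pos
    av-step : (S : Selection n k) → LegalMove p pos S → SafeMove pos S →
              EnforcerTurn p q (apply pos S avoider) → AvoiderTurn p q pos

startPosition : (n k : ℕ) → Position n k
startPosition n k i j = free

AvoiderNeverDangerous : (n k p q : ℕ) → Set
AvoiderNeverDangerous n k p q = EnforcerTurn {n} {k} p q (startPosition n k)

module Submission where

-- Let d = gcd (p + q) k, so d ∣ k, d ∣ p + q and p < d.  Call a
-- box touched if Enforcer owns an element of it.  Avoider keeps two invariants
-- at every Enforcer turn: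
--   (G) every box containing an Avoider element is touched;
--   (D) d divides the number of claimed elements.
-- After Enforcer's move (q new claimed elements) the claimed elements all lie
-- in touched boxes by (G), so  safe + claimed = k · #touched ≡ 0 (mod d),
-- while claimed + p ≡ 0 (mod d) by (D) and d ∣ p + q.  Hence the number of
-- safe elements is ≡ p (mod d), and as p < d it is at least p.  Avoider claims
-- p safe elements; this keeps (G), and (D) holds again as p + q elements were
-- claimed in the round.  The game is finite, so the strategy is built by
-- recursion on the number of unclaimed elements.

open import Defs
open import Data.Nat using (ℕ; zero; suc; _+_; _*_; _∸_; _⊓_; _≤_; _<_; z≤n; s≤s; s≤s⁻¹; _≤?_; >-nonZero)
open import Data.Nat.Properties
open import Data.Nat.Divisibility using (_∣_; _∣0; ∣m∣n⇒∣m+n; ∣m+n∣m⇒∣n; ∣-trans; m∣m*n; ∣⇒≤)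
open import Data.Nat.GCD using (gcd; gcd[m,n]∣m; gcd[m,n]∣n)
import Data.Nat.ListAction as ListAction
open import Algebra.Properties.CommutativeMonoid.Sum +-0-commutativeMonoid
  using (sum-syntax; sum-cong-≗; ∑-distrib-+; sum-replicate-zero)
open import Data.Fin using (Fin; zero; suc)
open import Data.Fin.Properties using (any?)
open import Data.Bool using (Bool; true; false; if_then_else_; _∧_; not)
open import Data.List using (map; tabulate)
open import Data.Product using (Σ; ∃; _×_; _,_; proj₁; proj₂)
open import Data.Sum using (inj₁; inj₂)
open import Relation.Nullary using (Dec; yes; no; does; contradiction)
open import Relation.Binary.PropositionalEquality
open import Function using (_∘_)

ind : Bool → ℕ
ind b = if b then 1 else 0

∑-mono-≤ : ∀ n {f g : Fin n → ℕ} → (∀ i → f i ≤ g i) → ∑[ i < n ] f i ≤ ∑[ i < n ] g i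
∑-mono-≤ zero    f≤g = z≤n
∑-mono-≤ (suc n) f≤g = +-mono-≤ (f≤g zero) (∑-mono-≤ n (f≤g ∘ suc))

∑-const : ∀ n c → ∑[ i < n ] c ≡ n * c
∑-const zero    c = refl
∑-const (suc n) c = cong (c +_) (∑-const n c)

∑-∣ : ∀ n {d} {f : Fin n → ℕ} → (∀ i → d ∣ f i) → d ∣ ∑[ i < n ] f i
∑-∣ zero    {d} _   = d ∣0
∑-∣ (suc n)     d∣f = ∣m∣n⇒∣m+n (d∣f zero) (∑-∣ n (d∣f ∘ suc))

term≤∑ : ∀ {n} (f : Fin n → ℕ) i → f i ≤ ∑[ x < n ] f x
term≤∑ f zero    = m≤m+n (f zero) _
term≤∑ f (suc i) = ≤-trans (term≤∑ (f ∘ suc) i) (m≤n+m _ (f zero))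

listSum-map-tabulate : ∀ {A : Set} n (g : Fin n → A) (f : A → ℕ) →
                       ListAction.sum (map f (tabulate g)) ≡ ∑[ i < n ] f (g i)
listSum-map-tabulate zero    g f = refl
listSum-map-tabulate (suc n) g f = cong (f (g zero) +_) (listSum-map-tabulate n (g ∘ suc) f)

total : ∀ {n k} → (Fin n → Fin k → ℕ) → ℕ
total {n} {k} F = ∑[ i < n ] ∑[ j < k ] F i j

total-cong : ∀ {n k} {F G : Fin n → Fin k → ℕ} → (∀ i j → F i j ≡ G i j) → total F ≡ total G
total-cong F≗G = sum-cong-≗ (λ i → sum-cong-≗ (F≗G i))

total-+ : ∀ {n k} (F G : Fin n → Fin k → ℕ) → total (λ i j → F i j + G i j) ≡ total F + total G
total-+ {n} {k} F G = trans (sum-cong-≗ (λ i → ∑-distrib-+ (F i) (G i)))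
                            (∑-distrib-+ (λ i → ∑[ j < k ] F i j) (λ i → ∑[ j < k ] G i j))

term≤total : ∀ {n k} (F : Fin n → Fin k → ℕ) i j → F i j ≤ total F
term≤total {k = k} F i j = ≤-trans (term≤∑ (F i) j) (term≤∑ (λ i → ∑[ j < k ] F i j) i)

count-total : ∀ {n k} (S : Selection n k) → count S ≡ total (λ i j → ind (S i j))
count-total {n} {k} S =
  trans (listSum-map-tabulate n (λ i → i)
           (λ i → ListAction.sum (map (λ j → ind (S i j)) (tabulate (λ j → j)))))
        (sum-cong-≗ (λ i → listSum-map-tabulate k (λ j → j) (λ j → ind (S i j))))

count-empty : ∀ {n k} → count {n} {k} (λ _ _ → false) ≡ 0
count-empty {n} {k} =
  trans (count-total {n} {k} (λ _ _ → false))
        (trans (sum-cong-≗ {n} (λ _ → sum-replicate-zero k)) (sum-replicate-zero n))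

count-⊆ : ∀ {n k} {A B : Selection n k} → (∀ i j → A i j ≡ true → B i j ≡ true) →
          count A ≤ count B
count-⊆ {A = A} {B} A⊆B =
  subst₂ _≤_ (sym (count-total A)) (sym (count-total B)) (total-mono-≤ ind-mono)
  where
  total-mono-≤ : ∀ {n k} {F G : Fin n → Fin k → ℕ} → (∀ i j → F i j ≤ G i j) → total F ≤ total G
  total-mono-≤ {n} {k} F≤G = ∑-mono-≤ n (λ i → ∑-mono-≤ k (F≤G i))
  ind-mono : ∀ i j → ind (A i j) ≤ ind (B i j)
  ind-mono i j with A i j | A⊆B i j
  ... | true  | ⊆B rewrite ⊆B refl = ≤-refl
  ... | false | _ = z≤n

split-demand : ∀ n (c : Fin n → ℕ) m → m ≤ ∑[ i < n ] c i →
               Σ (Fin n → ℕ) λ a → (∀ i → a i ≤ c i) × ∑[ i < n ] a i ≡ m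
split-demand zero    c m m≤0 = (λ ()) , (λ ()) , sym (n≤0⇒n≡0 m≤0)
split-demand (suc n) c m m≤∑
  with split-demand n (c ∘ suc) (m ∸ c zero) (m≤n+o⇒m∸n≤o m (c zero) m≤∑)
... | a , a≤c , ∑a≡ = a′ , a′≤c , trans (cong (c zero ⊓ m +_) ∑a≡) (m⊓n+n∸m≡n (c zero) m)
  where
  a′ : Fin (suc n) → ℕ
  a′ zero    = c zero ⊓ m
  a′ (suc i) = a i
  a′≤c : ∀ i → a′ i ≤ c i
  a′≤c zero    = m⊓n≤m (c zero) m
  a′≤c (suc i) = a≤c i

pick : ∀ a b → a ≤ ind b → Σ Bool λ b′ → (b′ ≡ true → b ≡ true) × ind b′ ≡ a
pick zero          b     _        = false , (λ ()) , refl
pick (suc zero)    true  _        = true , (λ _ → refl) , refl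
pick (suc (suc a)) true  (s≤s ())
pick (suc a)       false ()

choose-subset : ∀ n (A : Fin n → Bool) m → m ≤ ∑[ i < n ] ind (A i) →
  Σ (Fin n → Bool) λ B → (∀ i → B i ≡ true → A i ≡ true) × ∑[ i < n ] ind (B i) ≡ m
choose-subset n A m m≤∑ with split-demand n (ind ∘ A) m m≤∑
... | a , a≤A , ∑a≡m = proj₁ ∘ picked , (proj₁ ∘ proj₂ ∘ picked)
                     , trans (sum-cong-≗ (proj₂ ∘ proj₂ ∘ picked)) ∑a≡m
  where
  picked : ∀ i → Σ Bool λ b′ → (b′ ≡ true → A i ≡ true) × ind b′ ≡ a i
  picked i = pick (a i) (A i) (a≤A i)

choose-subselection : ∀ {n k} (A : Selection n k) m → m ≤ count A →
  Σ (Selection n k) λ B → (∀ i j → B i j ≡ true → A i j ≡ true) × count B ≡ m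
choose-subselection {n} {k} A m m≤∣A∣
  with split-demand n (λ i → ∑[ j < k ] ind (A i j)) m (subst (m ≤_) (count-total A) m≤∣A∣)
... | a , a≤A , ∑a≡m = proj₁ ∘ row , (proj₁ ∘ proj₂ ∘ row)
                     , trans (count-total (proj₁ ∘ row)) (trans (sum-cong-≗ (proj₂ ∘ proj₂ ∘ row)) ∑a≡m)
  where
  row : ∀ i → Σ (Fin k → Bool) λ B → (∀ j → B j ≡ true → A i j ≡ true) × ∑[ j < k ] ind (B j) ≡ a i
  row i = choose-subset k (A i) (a i) (a≤A i)

-- If d ∣ s + c and d ∣ c + p with p < d, then s ≡ p (mod d) forces s ≥ p.
residue-lower-bound : ∀ {d s c p} → d ∣ s + c → d ∣ c + p → p < d → p ≤ s
residue-lower-bound {d} {s} {c} {p} d∣s+c d∣c+p p<d with p ≤? s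
... | yes p≤s = p≤s
... | no  p≰s = contradiction (∣⇒≤ ⦃ >-nonZero (m<n⇒0<n∸m s<p) ⦄ d∣gap)
                              (<⇒≱ (≤-<-trans (m∸n≤m p s) p<d))
  where
  open ≡-Reasoning
  s<p : s < p
  s<p = ≰⇒> p≰s
  fill : (s + c) + (p ∸ s) ≡ c + p
  fill = begin
    (s + c) + (p ∸ s) ≡⟨ cong (_+ (p ∸ s)) (+-comm s c) ⟩
    (c + s) + (p ∸ s) ≡⟨ +-assoc c s (p ∸ s) ⟩
    c + (s + (p ∸ s)) ≡⟨ cong (c +_) (m+[n∸m]≡n (<⇒≤ s<p)) ⟩
    c + p             ∎
  d∣gap : d ∣ p ∸ s
  d∣gap = ∣m+n∣m⇒∣n (subst (d ∣_) (sym fill) d∣c+p) d∣s+c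

full-bias : ∀ {b c rest} → c ≡ b ⊓ (rest + c) → 0 < rest → c ≡ b
full-bias {b} {c} {rest} c≡ 0<rest with ≤-total b (rest + c)
... | inj₁ b≤ = trans c≡ (m≤n⇒m⊓n≡m b≤)
... | inj₂ ≤b = contradiction (trans c≡ (m≥n⇒m⊓n≡n ≤b)) (<⇒≢ (m<n+m c 0<rest))

claimedCount : ∀ {n k} → Position n k → ℕ
claimedCount pos = count (λ i j → not (isFree (pos i j)))

Unclaimed : ∀ {n k} → Position n k → Selection n k → Set
Unclaimed pos S = ∀ i j → S i j ≡ true → pos i j ≡ free

claim-counts : ∀ {n k} (pos : Position n k) S o → Unclaimed pos S → isFree o ≡ false →
  freeCount pos ≡ freeCount (apply pos S o) + count S ×
  claimedCount (apply pos S o) ≡ claimedCount pos + count S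
claim-counts pos S o unclaimed o-claims =
  counted (λ i j → proj₁ (pointwise i j)) , counted (λ i j → proj₂ (pointwise i j))
  where
  pointwise : ∀ i j →
    ind (isFree (pos i j)) ≡ ind (isFree (apply pos S o i j)) + ind (S i j) ×
    ind (not (isFree (apply pos S o i j))) ≡ ind (not (isFree (pos i j))) + ind (S i j)
  pointwise i j with S i j | unclaimed i j
  ... | true  | S⊆free rewrite S⊆free refl | o-claims = refl , refl
  ... | false | _ = sym (+-identityʳ _) , sym (+-identityʳ _)
  counted : ∀ {A B : Selection _ _} → (∀ i j → ind (A i j) ≡ ind (B i j) + ind (S i j)) →
            count A ≡ count B + count S
  counted {A} {B} eq = begin
    count A                                       ≡⟨ count-total A ⟩
    total (λ i j → ind (A i j))                   ≡⟨ total-cong eq ⟩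
    total (λ i j → ind (B i j) + ind (S i j))     ≡⟨ total-+ (λ i j → ind (B i j)) (λ i j → ind (S i j)) ⟩
    total (λ i j → ind (B i j)) + total (λ i j → ind (S i j))
                                                  ≡⟨ sym (cong₂ _+_ (count-total B) (count-total S)) ⟩
    count B + count S                             ∎
    where open ≡-Reasoning

anyFree? : ∀ {n k} (pos : Position n k) → Dec (∃ λ i → ∃ λ j → pos i j ≡ free)
anyFree? pos = any? (λ i → any? (λ j → free? (pos i j)))
  where
  free? : (o : Owner) → Dec (o ≡ free)
  free? free     = yes refl
  free? avoider  = no λ ()
  free? enforcer = no λ ()

some-free⇒positive : ∀ {n k} (pos : Position n k) → (∃ λ i → ∃ λ j → pos i j ≡ free) →
                     0 < freeCount pos
some-free⇒positive pos (i , j , e) =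
  subst (0 <_) (sym (count-total (λ i j → isFree (pos i j))))
        (subst (λ o → ind (isFree o) ≤ total free-ind) e (term≤total free-ind i j))
  where
  free-ind = λ i j → ind (isFree (pos i j))

enforcer-persists : ∀ {n k} {pos : Position n k} {S o i j} → Unclaimed pos S →
                    pos i j ≡ enforcer → apply pos S o i j ≡ enforcer
enforcer-persists {S = S} {i = i} {j} unclaimed e with S i j | unclaimed i j
... | true  | S⊆free = contradiction (trans (sym e) (S⊆free refl)) λ ()
... | false | _      = e

touched? : ∀ {n k} (pos : Position n k) i → Dec (∃ λ j → pos i j ≡ enforcer)
touched? pos i = any? (λ j → enforcer? (pos i j))
  where
  enforcer? : (o : Owner) → Dec (o ≡ enforcer)
  enforcer? free     = no λ ()
  enforcer? avoider  = no λ ()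
  enforcer? enforcer = yes refl

safeSelection : ∀ {n k} → Position n k → Selection n k
safeSelection pos i j = does (touched? pos i) ∧ isFree (pos i j)

safeSelection-sound : ∀ {n k} (pos : Position n k) i j →
                      safeSelection pos i j ≡ true → SafeElement pos i j
safeSelection-sound pos i j sel with touched? pos i | pos i j in e
... | yes touched | free = refl , (j , e) , touched

AvoiderGuarded : ∀ {n k} → Position n k → Set
AvoiderGuarded pos = ∀ i j → pos i j ≡ avoider → ∃ λ j′ → pos i j′ ≡ enforcer

guarded-after-enforcer : ∀ {n k} {pos : Position n k} {S} → Unclaimed pos S →
                         AvoiderGuarded pos → AvoiderGuarded (apply pos S enforcer)
guarded-after-enforcer {S = S} unclaimed guarded i j with S i j
... | true  = λ ()
... | false = λ e → let (j′ , e′) = guarded i j e in j′ , enforcer-persists unclaimed e′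

guarded-after-safe-move : ∀ {n k} {pos : Position n k} {S} → SafeMove pos S →
                          AvoiderGuarded pos → AvoiderGuarded (apply pos S avoider)
guarded-after-safe-move {pos = pos} {S} safe guarded i j with S i j in s
... | true  = λ _ → keep (proj₂ (proj₂ (safe i j s)))
  where
  keep : (∃ λ j′ → pos i j′ ≡ enforcer) → ∃ λ j′ → apply pos S avoider i j′ ≡ enforcer
  keep (j′ , e′) = j′ , enforcer-persists (λ i j → proj₁ ∘ safe i j) e′
... | false = λ e → let (j′ , e′) = guarded i j e in
                    j′ , enforcer-persists (λ i j → proj₁ ∘ safe i j) e′

safe-or-claimed : ∀ {n k} (pos : Position n k) → AvoiderGuarded pos → ∀ i j →
  ind (safeSelection pos i j) + ind (not (isFree (pos i j))) ≡ ind (does (touched? pos i))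
safe-or-claimed pos guarded i j with touched? pos i | pos i j in e
... | yes _         | free     = refl
... | yes _         | avoider  = refl
... | yes _         | enforcer = refl
... | no  _         | free     = refl
... | no  untouched | avoider  = contradiction (guarded i j e) untouched
... | no  untouched | enforcer = contradiction (j , e) untouched

-- Hence safe + claimed = k · #touched boxes, a multiple of every d ∣ k.
safe+claimed-divisible : ∀ {n k d} (pos : Position n k) → d ∣ k → AvoiderGuarded pos →
                         d ∣ count (safeSelection pos) + claimedCount pos
safe+claimed-divisible {n} {k} pos d∣k guarded =
  subst (_ ∣_) (sym safe+claimed) (∑-∣ n (λ i → subst (_ ∣_) (sym (∑-const k _)) (∣-trans d∣k (m∣m*n _))))
  where
  open ≡-Reasoning
  claimed : Selection n k
  claimed i j = not (isFree (pos i j))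
  safe+claimed : count (safeSelection pos) + claimedCount pos ≡
                 ∑[ i < n ] ∑[ j < k ] ind (does (touched? pos i))
  safe+claimed = begin
    count (safeSelection pos) + claimedCount pos
      ≡⟨ cong₂ _+_ (count-total (safeSelection pos)) (count-total claimed) ⟩
    total (λ i j → ind (safeSelection pos i j)) + total (λ i j → ind (claimed i j))
      ≡⟨ sym (total-+ (λ i j → ind (safeSelection pos i j)) (λ i j → ind (claimed i j))) ⟩
    total (λ i j → ind (safeSelection pos i j) + ind (claimed i j))
      ≡⟨ total-cong (safe-or-claimed pos guarded) ⟩
    ∑[ i < n ] ∑[ j < k ] ind (does (touched? pos i)) ∎

safe-reply : ∀ {n k d p} (pos : Position n k) → d ∣ k → p < d → AvoiderGuarded pos →
             d ∣ claimedCount pos + p →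
             Σ (Selection n k) λ S → LegalMove p pos S × SafeMove pos S × count S ≡ p
safe-reply {p = p} pos d∣k p<d guarded d∣claimed+p
  with choose-subselection (safeSelection pos) p enough-safe
  where
  enough-safe : p ≤ count (safeSelection pos)
  enough-safe = residue-lower-bound (safe+claimed-divisible pos d∣k guarded) d∣claimed+p p<d
... | S , S⊆safe , |S|≡p = S , (unclaimed , legal-size) , safe , |S|≡p
  where
  safe : SafeMove pos S
  safe i j = safeSelection-sound pos i j ∘ S⊆safe i j
  unclaimed : Unclaimed pos S
  unclaimed i j = proj₁ ∘ safe i j
  S⊆free : ∀ i j → S i j ≡ true → isFree (pos i j) ≡ true
  S⊆free i j s rewrite unclaimed i j s = refl
  legal-size : count S ≡ p ⊓ freeCount pos
  legal-size = trans |S|≡p (sym (m≤n⇒m⊓n≡m (subst (_≤ freeCount pos) |S|≡p (count-⊆ S⊆free))))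

module Strategy {n k p q d : ℕ} (d∣k : d ∣ k) (d∣p+q : d ∣ p + q) (p<d : p < d) (0<p : 0 < p) where

  record Invariant (pos : Position n k) : Set where
    field
      guarded   : AvoiderGuarded pos
      d∣claimed : d ∣ claimedCount pos

  -- After a round (q elements for Enforcer, then p for Avoider) divisibility
  -- is restored, and already after Enforcer's q elements claimed + p ≡ 0.
  round-divisible : ∀ c → d ∣ c → d ∣ (c + q) + p
  round-divisible c d∣c = subst (d ∣_) regroup (∣m∣n⇒∣m+n d∣c d∣p+q)
    where
    regroup : c + (p + q) ≡ (c + q) + p
    regroup = trans (cong (c +_) (+-comm p q)) (sym (+-assoc c q p))

  -- The fuel bounds the number of unclaimed elements; each round claims at
  -- least p ≥ 1 of them.
  mutual
    enforcer-turn : ∀ fuel pos → freeCount pos ≤ fuel → Invariant pos → EnforcerTurn p q pos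
    enforcer-turn fuel pos bound inv with anyFree? pos
    ... | no none = enf-done (λ i j e → none (i , j , e))
    ... | yes some@(i , j , e) with fuel
    ...   | zero       = contradiction (≤-trans (some-free⇒positive pos some) bound) λ ()
    ...   | suc fuel′ = enf-step (λ claimed → claimed i j e) (avoider-turn fuel′ pos bound inv)

    avoider-turn : ∀ fuel pos → freeCount pos ≤ suc fuel → Invariant pos →
                   ∀ S → LegalMove q pos S → AvoiderTurn p q (apply pos S enforcer)
    avoider-turn fuel pos bound inv S (unclaimed , |S|≡) with anyFree? (apply pos S enforcer)
    ... | no none  = av-done (λ i j e → none (i , j , e))
    ... | yes some = av-step R legal safe (enforcer-turn fuel pos″ bound″ inv″)
      where
      open Invariant inv
      pos′ = apply pos S enforcer
      enforcer-counts = claim-counts pos S enforcer unclaimed refl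
      |S|≡q : count S ≡ q
      |S|≡q = full-bias (trans |S|≡ (cong (q ⊓_) (proj₁ enforcer-counts)))
                        (some-free⇒positive pos′ some)
      claimed′ : claimedCount pos′ ≡ claimedCount pos + q
      claimed′ = trans (proj₂ enforcer-counts) (cong (claimedCount pos +_) |S|≡q)
      d∣claimed′+p : d ∣ claimedCount pos′ + p
      d∣claimed′+p = subst (λ c → d ∣ c + p) (sym claimed′) (round-divisible _ d∣claimed)
      reply = safe-reply pos′ d∣k p<d (guarded-after-enforcer unclaimed guarded) d∣claimed′+p
      R     = proj₁ reply
      legal = proj₁ (proj₂ reply)
      safe  = proj₁ (proj₂ (proj₂ reply))
      pos″ = apply pos′ R avoider
      avoider-counts = claim-counts pos′ R avoider (proj₁ legal) refl
      |R|≡p : count R ≡ p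
      |R|≡p = proj₂ (proj₂ (proj₂ reply))
      inv″ : Invariant pos″
      inv″ = record
        { guarded   = guarded-after-safe-move safe (guarded-after-enforcer unclaimed guarded)
        ; d∣claimed = subst (d ∣_) (sym (trans (proj₂ avoider-counts)
                                              (cong (claimedCount pos′ +_) |R|≡p)))
                            d∣claimed′+p
        }
      bound″ : freeCount pos″ ≤ fuel
      bound″ = s≤s⁻¹ (begin-strict
        freeCount pos″              <⟨ m<m+n (freeCount pos″) 0<p ⟩
        freeCount pos″ + p          ≡⟨ sym (trans (proj₁ avoider-counts) (cong (freeCount pos″ +_) |R|≡p)) ⟩
        freeCount pos′              ≤⟨ m≤m+n (freeCount pos′) (count S) ⟩
        freeCount pos′ + count S    ≡⟨ sym (proj₁ enforcer-counts) ⟩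
        freeCount pos               ≤⟨ bound ⟩
        suc fuel                    ∎)
        where open ≤-Reasoning

lemma2p1 : (p q k n : ℕ) → 0 < p → 0 < q → 0 < k → 0 < n →
           p < gcd (p + q) k →
           AvoiderNeverDangerous n k p q
lemma2p1 p q k n 0<p _ _ _ p<gcd =
  Strategy.enforcer-turn (gcd[m,n]∣n (p + q) k) (gcd[m,n]∣m (p + q) k) p<gcd 0<p
    (freeCount start) start ≤-refl
    record { guarded = λ i j (); d∣claimed = subst (_ ∣_) (sym (count-empty {n} {k})) (_ ∣0) }
  where
  start = startPosition n k
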